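{- For $n\in\mathbb{N}$, $n\ge1$, let $r(2,n)$ denote the number of orbits of the left action of $\mathrm{SL}(2,\mathbb{Z})$ on $(\mathbb{Z}_2\times\mathbb{Z}_2)^n$. Then $$r(2,n)=\frac{2^{2n-1}+2^{n+1}-2^{n-1}+1}{3}=\frac{(2^n+1)(2^{n-1}+1)}{3}.$$
   Context: Elements of $(\mathbb{Z}_2\times\mathbb{Z}_2)^n$ are viewed as $2\times n$ matrices over $\mathbb{Z}_2$, and $S\in\mathrm{SL}(2,\mathbb{Z})$ acts by left matrix multiplication with the entries of $S$ reduced modulo $2$. -}

module Defs where

open import Data.Nat as ℕ using (ℕ; _≡ᵇ_; _%_)
open import Data.Integer as ℤ using (ℤ; ∣_∣; _-_; _*_)
open import Data.Bool using (Bool; _∧_; _xor_)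
open import Data.Fin using (Fin)
open import Data.Vec using (Vec; []; _∷_; zipWith; map)
open import Data.Product using (Σ; ∃; _×_; _,_)
open import Relation.Binary.PropositionalEquality using (_≡_)

-- Z_2 is modelled by Bool (false = 0, true = 1; xor = +, ∧ = ·).
Z2 : Set
Z2 = Bool

mod2 : ℤ → Z2
mod2 z = (∣ z ∣ % 2) ≡ᵇ 1

record SL2Z : Set where
  constructor mkSL
  field
    a b c d : ℤ
    det≡1   : a * d - b * c ≡ ℤ.+ 1

-- An element of (Z_2 × Z_2)^n viewed as a 2 × n matrix over Z_2 (two rows).
Mat2 : ℕ → Set
Mat2 n = Vec (Vec Z2 n) 2

_·ᵣ_ : ∀ {n} → Z2 → Vec Z2 n → Vec Z2 n
s ·ᵣ v = map (s ∧_) v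

_+ᵣ_ : ∀ {n} → Vec Z2 n → Vec Z2 n → Vec Z2 n
_+ᵣ_ = zipWith _xor_

act : ∀ {n} → SL2Z → Mat2 n → Mat2 n
act (mkSL a b c d _) (x₀ ∷ x₁ ∷ []) =
  ((mod2 a ·ᵣ x₀) +ᵣ (mod2 b ·ᵣ x₁)) ∷ ((mod2 c ·ᵣ x₀) +ᵣ (mod2 d ·ᵣ x₁)) ∷ []

SameOrbit : ∀ {n} → Mat2 n → Mat2 n → Set
SameOrbit x y = ∃ λ (S : SL2Z) → act S x ≡ y

HasOrbitCount : ℕ → ℕ → Set
HasOrbitCount n k =
  Σ (Fin k → Mat2 n) λ rep →
    (∀ i j → SameOrbit (rep i) (rep j) → i ≡ j) ×
    (∀ (x : Mat2 n) → ∃ λ i → SameOrbit (rep i) x)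

-- Reduced mod 2, SL(2,ℤ) acts on the columns of a 2 × n matrix through GL(2,F₂), which
-- permutes F₂² ∖ {0} and is simply transitive on ordered bases. Reading the columns from
-- left to right, an orbit is therefore determined by the positions of the zero columns
-- before the first nonzero column u, then by which later columns are 0 or u before the
-- first column w ∉ {0, u}, and finally by the coordinates of all remaining columns in the
-- basis (u, w). The numbers of such canonical forms satisfy
-- size₀ (m+1) = size₀ m + size₁ m and size₁ (m+1) = 2 size₁ m + 4^m,
-- whence 6 size₀ m = (2^m + 1)(2^m + 2).
module Submission where

open import Defs
open import Data.Nat using (ℕ; _+_; _*_; _∸_; _^_; _/_; _≥_)
open import Data.Nat.Divisibility using (_∣_)
open import Data.Product using (_×_)
open import Relation.Binary.PropositionalEquality using (_≡_)

open import Data.Bool using (Bool; true; false; not; _∧_; _xor_; if_then_else_)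
open import Data.Bool.Properties as Bool
  using (not-involutive; not-distribˡ-xor; xor-comm; xor-identityʳ; xor-same;
         xor-annihilates-not; ∧-zeroʳ; ∧-comm)
open import Data.Empty using (⊥-elim)
open import Data.Fin using (Fin)
open import Data.Fin.Properties using (1↔⊤; 2↔Bool; +↔⊎; *↔×)
open import Data.Integer as ℤ using (ℤ; -[1+_]; _⊖_; 0ℤ; 1ℤ; -1ℤ)
open import Data.Integer.Properties using (abs-*; ∣-i∣≡∣i∣; [1+m]⊖[1+n]≡m⊖n)
open import Data.Nat as ℕ using (zero; suc; _%_; _≡ᵇ_)
open import Data.Nat.Divisibility using (divides)
open import Data.Nat.DivMod using (m*n/n≡m)
open import Data.Nat.Properties
  using (*-cancelˡ-≡; ^-distribˡ-+-*; m+n∸n≡m; +-identityʳ)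
open import Data.Nat.Tactic.RingSolver using (solve-∀)
open import Data.Product using (∃; ∃₂; _,_; proj₁; uncurry)
open import Data.Product.Function.NonDependent.Propositional using (_×-↔_)
open import Data.Product.Properties using (≡-dec)
open import Data.Sum using (_⊎_; inj₁; inj₂)
open import Data.Sum.Function.Propositional using (_⊎-↔_)
open import Data.Unit using (⊤; tt)
open import Data.Vec using (Vec; []; _∷_; map; zip; unzip)
open import Data.Vec.Properties using (map-∘; map-cong; map-id; zip∘unzip; unzip∘zip)
open import Function using (_∘_)
open import Function.Bundles using (Inverse; Injection; _↔_; mk↔ₛ′)
open import Function.Definitions using (Injective)
open import Function.Properties.Inverse using (↔-trans; ↔⇒↣)
open import Relation.Binary.Definitions using (DecidableEquality)
open import Relation.Binary.PropositionalEquality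
  using (_≢_; refl; sym; trans; cong; cong₂; subst; module ≡-Reasoning)
open import Relation.Nullary using (does; yes; no)
open import Relation.Nullary.Decidable using (dec-true; dec-false)

open ≡-Reasoning

-- Canonical forms of sequences of vectors in F₂²

F₂² : Set
F₂² = Z2 × Z2

𝟎 e₁ e₂ e₁+e₂ : F₂²
𝟎 = false , false
e₁ = true , false
e₂ = false , true
e₁+e₂ = true , true

_≟_ : DecidableEquality F₂²
_≟_ = ≡-dec Bool._≟_ Bool._≟_

_==_ : F₂² → F₂² → Bool
u == v = does (u ≟ v)

==-invariant : ∀ {f : F₂² → F₂²} → Injective _≡_ _≡_ f → ∀ u v → f u == f v ≡ u == v
==-invariant {f} f-injective u v with u ≟ v
... | yes refl = dec-true (f u ≟ f u) refl
... | no u≢v = dec-false (f u ≟ f v) (u≢v ∘ f-injective)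

-- The coordinates of v in the basis (u, w) of F₂² = {0, u, w, u + w}.
coordinates : F₂² → F₂² → F₂² → F₂²
coordinates u w v =
  if v == 𝟎 then 𝟎 else if v == u then e₁ else if v == w then e₂ else e₁+e₂

F₂²-cases : ∀ {P : F₂² → Set} → P 𝟎 → P e₁ → P e₂ → P e₁+e₂ → ∀ v → P v
F₂²-cases p𝟎 _ _ _ (false , false) = p𝟎
F₂²-cases _ pe₁ _ _ (true , false) = pe₁
F₂²-cases _ _ pe₂ _ (false , true) = pe₂
F₂²-cases _ _ _ pe₁+e₂ (true , true) = pe₁+e₂

coordinates-standard : ∀ v → coordinates e₁ e₂ v ≡ v
coordinates-standard = F₂²-cases refl refl refl refl

-- Canonical₀ m: canonical forms of m columns; Canonical₁ m: canonical forms of m columns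
-- following a prefix that spans a line.
Canonical₁ : ℕ → Set
Canonical₁ zero = ⊤
Canonical₁ (suc m) = Canonical₁ m ⊎ (Canonical₁ m ⊎ Vec F₂² m)

Canonical₀ : ℕ → Set
Canonical₀ zero = ⊤
Canonical₀ (suc m) = Canonical₀ m ⊎ Canonical₁ m

decode₁ : ∀ {m} → Canonical₁ m → Vec F₂² m
decode₁ {zero} tt = []
decode₁ {suc m} (inj₁ c) = 𝟎 ∷ decode₁ c
decode₁ {suc m} (inj₂ (inj₁ c)) = e₁ ∷ decode₁ c
decode₁ {suc m} (inj₂ (inj₂ vs)) = e₂ ∷ vs

decode₀ : ∀ {m} → Canonical₀ m → Vec F₂² m
decode₀ {zero} tt = []
decode₀ {suc m} (inj₁ c) = 𝟎 ∷ decode₀ c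
decode₀ {suc m} (inj₂ c) = e₁ ∷ decode₁ c

encode₁ : ∀ {m} → F₂² → Vec F₂² m → Canonical₁ m
encode₁ u [] = tt
encode₁ u (v ∷ vs) =
  if v == 𝟎 then inj₁ (encode₁ u vs)
  else if v == u then inj₂ (inj₁ (encode₁ u vs))
  else inj₂ (inj₂ (map (coordinates u v) vs))

encode₀ : ∀ {m} → Vec F₂² m → Canonical₀ m
encode₀ [] = tt
encode₀ (v ∷ vs) = if v == 𝟎 then inj₁ (encode₀ vs) else inj₂ (encode₁ v vs)

map-coordinates-standard : ∀ {m} (vs : Vec F₂² m) → map (coordinates e₁ e₂) vs ≡ vs
map-coordinates-standard vs = trans (map-cong coordinates-standard vs) (map-id vs)

encode₁-decode₁ : ∀ {m} (c : Canonical₁ m) → encode₁ e₁ (decode₁ c) ≡ c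
encode₁-decode₁ {zero} tt = refl
encode₁-decode₁ {suc m} (inj₁ c) = cong inj₁ (encode₁-decode₁ c)
encode₁-decode₁ {suc m} (inj₂ (inj₁ c)) = cong (inj₂ ∘ inj₁) (encode₁-decode₁ c)
encode₁-decode₁ {suc m} (inj₂ (inj₂ vs)) = cong (inj₂ ∘ inj₂) (map-coordinates-standard vs)

encode₀-decode₀ : ∀ {m} (c : Canonical₀ m) → encode₀ (decode₀ c) ≡ c
encode₀-decode₀ {zero} tt = refl
encode₀-decode₀ {suc m} (inj₁ c) = cong inj₁ (encode₀-decode₀ c)
encode₀-decode₀ {suc m} (inj₂ c) = cong inj₂ (encode₁-decode₁ c)

module Invariance {f : F₂² → F₂²} (f-injective : Injective _≡_ _≡_ f) (f-𝟎 : f 𝟎 ≡ 𝟎) where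

  ==𝟎-invariant : ∀ v → f v == 𝟎 ≡ v == 𝟎
  ==𝟎-invariant v = trans (cong (f v ==_) (sym f-𝟎)) (==-invariant f-injective v 𝟎)

  coordinates-invariant : ∀ u w v → coordinates (f u) (f w) (f v) ≡ coordinates u w v
  coordinates-invariant u w v
    rewrite ==𝟎-invariant v | ==-invariant f-injective v u | ==-invariant f-injective v w
    = refl

  map-coordinates-invariant : ∀ {m} u w (vs : Vec F₂² m) →
    map (coordinates (f u) (f w)) (map f vs) ≡ map (coordinates u w) vs
  map-coordinates-invariant u w vs =
    trans (sym (map-∘ _ f vs)) (map-cong (coordinates-invariant u w) vs)

  encode₁-invariant : ∀ {m} u (vs : Vec F₂² m) → encode₁ (f u) (map f vs) ≡ encode₁ u vs
  encode₁-invariant u [] = refl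
  encode₁-invariant u (v ∷ vs)
    rewrite ==𝟎-invariant v | ==-invariant f-injective v u
    with v == 𝟎 | v == u
  ... | true | _ = cong inj₁ (encode₁-invariant u vs)
  ... | false | true = cong (inj₂ ∘ inj₁) (encode₁-invariant u vs)
  ... | false | false = cong (inj₂ ∘ inj₂) (map-coordinates-invariant u v vs)

  encode₀-invariant : ∀ {m} (vs : Vec F₂² m) → encode₀ (map f vs) ≡ encode₀ vs
  encode₀-invariant [] = refl
  encode₀-invariant (v ∷ vs) rewrite ==𝟎-invariant v with v == 𝟎
  ... | true = cong inj₁ (encode₀-invariant vs)
  ... | false = cong inj₂ (encode₁-invariant v vs)

extend-to-basis : ∀ u → u ≢ 𝟎 → ∃ λ w → w ≢ 𝟎 × w ≢ u
extend-to-basis (false , false) u≢𝟎 = ⊥-elim (u≢𝟎 refl)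
extend-to-basis (true , false) _ = e₂ , (λ ()) , (λ ())
extend-to-basis (false , true) _ = e₁ , (λ ()) , (λ ())
extend-to-basis (true , true) _ = e₁ , (λ ()) , (λ ())

module Realisation
  {G : Set} (_⊙_ : G → F₂² → F₂²)
  (⊙-𝟎 : ∀ g → g ⊙ 𝟎 ≡ 𝟎)
  (⊙-injective : ∀ g → Injective _≡_ _≡_ (g ⊙_))
  (⊙-surjective : ∀ g v → ∃ λ u → g ⊙ u ≡ v)
  (⊙-basis : ∀ u w → u ≢ 𝟎 → w ≢ 𝟎 → w ≢ u → ∃ λ g → g ⊙ e₁ ≡ u × g ⊙ e₂ ≡ w)
  where

  ⊙-line : ∀ u → u ≢ 𝟎 → ∃ λ g → g ⊙ e₁ ≡ u
  ⊙-line u u≢𝟎 with extend-to-basis u u≢𝟎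
  ... | w , w≢𝟎 , w≢u with ⊙-basis u w u≢𝟎 w≢𝟎 w≢u
  ...   | g , ge₁≡u , _ = g , ge₁≡u

  -- The coordinates w.r.t. (g e₁, g e₂) of g u are those of u w.r.t. (e₁, e₂), i.e. u.
  ⊙-coordinates : ∀ g v → g ⊙ coordinates (g ⊙ e₁) (g ⊙ e₂) v ≡ v
  ⊙-coordinates g v with ⊙-surjective g v
  ... | u , refl = cong (g ⊙_)
    (trans (coordinates-invariant e₁ e₂ u) (coordinates-standard u))
    where open Invariance (⊙-injective g) (⊙-𝟎 g)

  map-⊙-coordinates : ∀ {m} g (vs : Vec F₂² m) →
    map (g ⊙_) (map (coordinates (g ⊙ e₁) (g ⊙ e₂)) vs) ≡ vs
  map-⊙-coordinates g vs =
    trans (sym (map-∘ _ _ vs)) (trans (map-cong (⊙-coordinates g) vs) (map-id vs))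

  realise₁ : ∀ {m} u (vs : Vec F₂² m) → u ≢ 𝟎 →
    ∃₂ λ (c : Canonical₁ m) g → g ⊙ e₁ ≡ u × map (g ⊙_) (decode₁ c) ≡ vs
  realise₁ u [] u≢𝟎 with ⊙-line u u≢𝟎
  ... | g , ge₁≡u = tt , g , ge₁≡u , refl
  realise₁ u (v ∷ vs) u≢𝟎 with v ≟ 𝟎 | v ≟ u
  ... | yes refl | _ with realise₁ u vs u≢𝟎
  ...   | c , g , ge₁≡u , gc≡vs = inj₁ c , g , ge₁≡u , cong₂ _∷_ (⊙-𝟎 g) gc≡vs
  realise₁ u (v ∷ vs) u≢𝟎 | no _ | yes refl with realise₁ u vs u≢𝟎
  ...   | c , g , ge₁≡u , gc≡vs = inj₂ (inj₁ c) , g , ge₁≡u , cong₂ _∷_ ge₁≡u gc≡vs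
  realise₁ u (v ∷ vs) u≢𝟎 | no v≢𝟎 | no v≢u with ⊙-basis u v u≢𝟎 v≢𝟎 v≢u
  ...   | g , refl , refl =
    inj₂ (inj₂ (map (coordinates u v) vs)) , g , refl , cong (_ ∷_) (map-⊙-coordinates g vs)

  realise₀ : ∀ {m} (vs : Vec F₂² m) → ∃₂ λ (c : Canonical₀ m) g → map (g ⊙_) (decode₀ c) ≡ vs
  realise₀ [] = tt , proj₁ (⊙-line e₁ (λ ())) , refl
  realise₀ (v ∷ vs) with v ≟ 𝟎
  ... | yes refl with realise₀ vs
  ...   | c , g , gc≡vs = inj₁ c , g , cong₂ _∷_ (⊙-𝟎 g) gc≡vs
  realise₀ (v ∷ vs) | no v≢𝟎 with realise₁ v vs v≢𝟎
  ...   | c , g , ge₁≡v , gc≡vs = inj₂ c , g , cong₂ _∷_ ge₁≡v gc≡vs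

-- Counting canonical forms

size₁ : ℕ → ℕ
size₁ zero = 1
size₁ (suc m) = size₁ m + (size₁ m + 4 ^ m)

size₀ : ℕ → ℕ
size₀ zero = 1
size₀ (suc m) = size₀ m + size₁ m

4↔F₂² : Fin 4 ↔ F₂²
4↔F₂² = ↔-trans *↔× (2↔Bool ×-↔ 2↔Bool)

^↔Vec : ∀ {A : Set} {k} m → Fin k ↔ A → Fin (k ^ m) ↔ Vec A m
^↔Vec zero _ = ↔-trans 1↔⊤ (mk↔ₛ′ (λ _ → []) (λ _ → tt) (λ { [] → refl }) (λ _ → refl))
^↔Vec (suc m) k↔A = ↔-trans *↔× (↔-trans (k↔A ×-↔ ^↔Vec m k↔A) ×↔∷)
  where
  ×↔∷ : ∀ {A : Set} {m} → (A × Vec A m) ↔ Vec A (suc m)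
  ×↔∷ = mk↔ₛ′ (uncurry _∷_) (λ { (x ∷ xs) → x , xs }) (λ { (x ∷ xs) → refl }) (λ _ → refl)

size₁↔Canonical₁ : ∀ m → Fin (size₁ m) ↔ Canonical₁ m
size₁↔Canonical₁ zero = 1↔⊤
size₁↔Canonical₁ (suc m) =
  ↔-trans +↔⊎ (size₁↔Canonical₁ m ⊎-↔ ↔-trans +↔⊎ (size₁↔Canonical₁ m ⊎-↔ ^↔Vec m 4↔F₂²))

size₀↔Canonical₀ : ∀ m → Fin (size₀ m) ↔ Canonical₀ m
size₀↔Canonical₀ zero = 1↔⊤
size₀↔Canonical₀ (suc m) = ↔-trans +↔⊎ (size₀↔Canonical₀ m ⊎-↔ size₁↔Canonical₁ m)

record M₂ : Set where
  constructor mat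
  field a b c d : Z2

_·_ : M₂ → F₂² → F₂²
mat a b c d · (p , q) = (a ∧ p) xor (b ∧ q) , (c ∧ p) xor (d ∧ q)

det : M₂ → Z2
det (mat a b c d) = (a ∧ d) xor (b ∧ c)

adj : M₂ → M₂
adj (mat a b c d) = mat d b c a

·-𝟎 : ∀ g → g · 𝟎 ≡ 𝟎
·-𝟎 (mat a b c d) rewrite ∧-zeroʳ a | ∧-zeroʳ b | ∧-zeroʳ c | ∧-zeroʳ d = refl

adj-· : ∀ g → det g ≡ true → ∀ v → adj g · (g · v) ≡ v
adj-· (mat false false _ _) ()
adj-· (mat false true false _) ()
adj-· (mat false true true false) _ = F₂²-cases refl refl refl refl
adj-· (mat false true true true) _ = F₂²-cases refl refl refl refl
adj-· (mat true false _ false) ()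
adj-· (mat true false false true) _ = F₂²-cases refl refl refl refl
adj-· (mat true false true true) _ = F₂²-cases refl refl refl refl
adj-· (mat true true false false) ()
adj-· (mat true true false true) _ = F₂²-cases refl refl refl refl
adj-· (mat true true true false) _ = F₂²-cases refl refl refl refl
adj-· (mat true true true true) ()

·-adj : ∀ g → det g ≡ true → ∀ v → g · (adj g · v) ≡ v
·-adj g@(mat a b c d) det≡1 = adj-· (adj g) (trans (cong (_xor (b ∧ c)) (∧-comm d a)) det≡1)

odd : ℕ → Bool
odd zero = false
odd (suc n) = not (odd n)

mod2≡odd∣∣ : ∀ z → mod2 z ≡ odd ℤ.∣ z ∣
mod2≡odd∣∣ z = odd-% ℤ.∣ z ∣
  where
  odd-% : ∀ n → (n % 2 ≡ᵇ 1) ≡ odd n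
  odd-% 0 = refl
  odd-% 1 = refl
  odd-% (suc (suc n)) = trans (odd-% n) (sym (not-involutive (odd n)))

odd-+ : ∀ m n → odd (m ℕ.+ n) ≡ odd m xor odd n
odd-+ zero n = refl
odd-+ (suc m) n = trans (cong not (odd-+ m n)) (not-distribˡ-xor (odd m) (odd n))

odd-* : ∀ m n → odd (m ℕ.* n) ≡ odd m ∧ odd n
odd-* zero n = refl
odd-* (suc m) n = begin
  odd (n ℕ.+ m ℕ.* n)        ≡⟨ odd-+ n (m ℕ.* n) ⟩
  odd n xor odd (m ℕ.* n)    ≡⟨ cong (odd n xor_) (odd-* m n) ⟩
  odd n xor (odd m ∧ odd n)  ≡⟨ absorb (odd m) (odd n) ⟩
  not (odd m) ∧ odd n        ∎
  where
  absorb : ∀ a b → b xor (a ∧ b) ≡ not a ∧ b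
  absorb false b = xor-identityʳ b
  absorb true b = xor-same b

odd-∣⊖∣ : ∀ m n → odd ℤ.∣ m ⊖ n ∣ ≡ odd m xor odd n
odd-∣⊖∣ m zero = sym (xor-identityʳ (odd m))
odd-∣⊖∣ zero (suc n) = refl
odd-∣⊖∣ (suc m) (suc n) = begin
  odd ℤ.∣ suc m ⊖ suc n ∣    ≡⟨ cong (odd ∘ ℤ.∣_∣) ([1+m]⊖[1+n]≡m⊖n m n) ⟩
  odd ℤ.∣ m ⊖ n ∣            ≡⟨ odd-∣⊖∣ m n ⟩
  odd m xor odd n            ≡⟨ xor-annihilates-not (odd m) (odd n) ⟨
  not (odd m) xor not (odd n) ∎

mod2-+ : ∀ i j → mod2 (i ℤ.+ j) ≡ mod2 i xor mod2 j
mod2-+ i j rewrite mod2≡odd∣∣ (i ℤ.+ j) | mod2≡odd∣∣ i | mod2≡odd∣∣ j = odd∣∣-+ i j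
  where
  odd∣∣-+ : ∀ i j → odd ℤ.∣ i ℤ.+ j ∣ ≡ odd ℤ.∣ i ∣ xor odd ℤ.∣ j ∣
  odd∣∣-+ (ℤ.+ m) (ℤ.+ n) = odd-+ m n
  odd∣∣-+ (ℤ.+ m) -[1+ n ] = odd-∣⊖∣ m (suc n)
  odd∣∣-+ -[1+ m ] (ℤ.+ n) = trans (odd-∣⊖∣ n (suc m)) (xor-comm (odd n) (not (odd m)))
  odd∣∣-+ -[1+ m ] -[1+ n ] =
    trans (not-involutive _) (trans (odd-+ m n) (sym (xor-annihilates-not (odd m) (odd n))))

mod2-- : ∀ i j → mod2 (i ℤ.- j) ≡ mod2 i xor mod2 j
mod2-- i j = trans (mod2-+ i (ℤ.- j)) (cong (mod2 i xor_) (mod2-neg j))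
  where
  mod2-neg : ∀ i → mod2 (ℤ.- i) ≡ mod2 i
  mod2-neg i rewrite mod2≡odd∣∣ (ℤ.- i) | mod2≡odd∣∣ i = cong odd (∣-i∣≡∣i∣ i)

mod2-* : ∀ i j → mod2 (i ℤ.* j) ≡ mod2 i ∧ mod2 j
mod2-* i j rewrite mod2≡odd∣∣ (i ℤ.* j) | mod2≡odd∣∣ i | mod2≡odd∣∣ j | abs-* i j =
  odd-* ℤ.∣ i ∣ ℤ.∣ j ∣

reduce : SL2Z → M₂
reduce (mkSL a b c d _) = mat (mod2 a) (mod2 b) (mod2 c) (mod2 d)

det-reduce : ∀ S → det (reduce S) ≡ true
det-reduce (mkSL a b c d ad-bc≡1) = begin
  (mod2 a ∧ mod2 d) xor (mod2 b ∧ mod2 c)  ≡⟨ cong₂ _xor_ (mod2-* a d) (mod2-* b c) ⟨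
  mod2 (a ℤ.* d) xor mod2 (b ℤ.* c)        ≡⟨ mod2-- (a ℤ.* d) (b ℤ.* c) ⟨
  mod2 (a ℤ.* d ℤ.- b ℤ.* c)               ≡⟨ cong mod2 ad-bc≡1 ⟩
  true                                     ∎

_⊙_ : SL2Z → F₂² → F₂²
S ⊙ v = reduce S · v

⊙-𝟎 : ∀ S → S ⊙ 𝟎 ≡ 𝟎
⊙-𝟎 S = ·-𝟎 (reduce S)

⊙-injective : ∀ S → Injective _≡_ _≡_ (S ⊙_)
⊙-injective S {u} {v} Su≡Sv = begin
  u                          ≡⟨ adj-· (reduce S) (det-reduce S) u ⟨
  adj (reduce S) · (S ⊙ u)   ≡⟨ cong (adj (reduce S) ·_) Su≡Sv ⟩
  adj (reduce S) · (S ⊙ v)   ≡⟨ adj-· (reduce S) (det-reduce S) v ⟩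
  v                          ∎

⊙-surjective : ∀ S v → ∃ λ u → S ⊙ u ≡ v
⊙-surjective S v = adj (reduce S) · v , ·-adj (reduce S) (det-reduce S) v

-- The 0/±1 lifts of the matrices with columns (u, w), signed to have determinant 1.
⊙-basis : ∀ u w → u ≢ 𝟎 → w ≢ 𝟎 → w ≢ u → ∃ λ S → S ⊙ e₁ ≡ u × S ⊙ e₂ ≡ w
⊙-basis (false , false) _ u≢𝟎 _ _ = ⊥-elim (u≢𝟎 refl)
⊙-basis _ (false , false) _ w≢𝟎 _ = ⊥-elim (w≢𝟎 refl)
⊙-basis (true , false) (true , false) _ _ w≢u = ⊥-elim (w≢u refl)
⊙-basis (false , true) (false , true) _ _ w≢u = ⊥-elim (w≢u refl)
⊙-basis (true , true) (true , true) _ _ w≢u = ⊥-elim (w≢u refl)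
⊙-basis (true , false) (false , true) _ _ _ = mkSL 1ℤ 0ℤ 0ℤ 1ℤ refl , refl , refl
⊙-basis (true , false) (true , true) _ _ _ = mkSL 1ℤ 1ℤ 0ℤ 1ℤ refl , refl , refl
⊙-basis (false , true) (true , false) _ _ _ = mkSL 0ℤ 1ℤ -1ℤ 0ℤ refl , refl , refl
⊙-basis (false , true) (true , true) _ _ _ = mkSL 0ℤ 1ℤ -1ℤ 1ℤ refl , refl , refl
⊙-basis (true , true) (true , false) _ _ _ = mkSL 1ℤ 1ℤ -1ℤ 0ℤ refl , refl , refl
⊙-basis (true , true) (false , true) _ _ _ = mkSL 1ℤ 0ℤ 1ℤ 1ℤ refl , refl , refl

columns : ∀ {n} → Mat2 n → Vec F₂² n
columns (x₀ ∷ x₁ ∷ []) = zip x₀ x₁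

rows : ∀ {n} → Vec F₂² n → Mat2 n
rows vs = let x₀ , x₁ = unzip vs in x₀ ∷ x₁ ∷ []

columns-rows : ∀ {n} (vs : Vec F₂² n) → columns (rows vs) ≡ vs
columns-rows = zip∘unzip

rows-columns : ∀ {n} (x : Mat2 n) → rows (columns x) ≡ x
rows-columns (x₀ ∷ x₁ ∷ []) = cong (λ (x₀ , x₁) → x₀ ∷ x₁ ∷ []) (unzip∘zip x₀ x₁)

columns-injective : ∀ {n} {x y : Mat2 n} → columns x ≡ columns y → x ≡ y
columns-injective {x = x} {y} x≡y =
  trans (sym (rows-columns x)) (trans (cong rows x≡y) (rows-columns y))

act-columns : ∀ {n} S (x : Mat2 n) → columns (act S x) ≡ map (S ⊙_) (columns x)
act-columns (mkSL a b c d _) (x₀ ∷ x₁ ∷ []) = zip-rows x₀ x₁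
  where
  zip-rows : ∀ {n} (x₀ x₁ : Vec Z2 n) →
    zip ((mod2 a ·ᵣ x₀) +ᵣ (mod2 b ·ᵣ x₁)) ((mod2 c ·ᵣ x₀) +ᵣ (mod2 d ·ᵣ x₁))
      ≡ map (mat (mod2 a) (mod2 b) (mod2 c) (mod2 d) ·_) (zip x₀ x₁)
  zip-rows [] [] = refl
  zip-rows (p ∷ x₀) (q ∷ x₁) = cong (_ ∷_) (zip-rows x₀ x₁)

hasOrbitCount : ∀ {n k} {C : Set} (count : Fin k ↔ C)
  (decode : C → Vec F₂² n) (encode : Vec F₂² n → C) →
  (∀ S vs → encode (map (S ⊙_) vs) ≡ encode vs) →
  (∀ c → encode (decode c) ≡ c) →
  (∀ vs → ∃₂ λ c S → map (S ⊙_) (decode c) ≡ vs) →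
  HasOrbitCount n k
hasOrbitCount {n} {k} count decode encode encode-invariant encode-decode realise =
  representative , distinct , exhaustive
  where
  open Inverse count using (to; from; strictlyInverseˡ)

  representative : Fin k → Mat2 n
  representative i = rows (decode (to i))

  columns-act-representative : ∀ S i →
    columns (act S (representative i)) ≡ map (S ⊙_) (decode (to i))
  columns-act-representative S i = trans (act-columns S (representative i))
    (cong (map (S ⊙_)) (columns-rows (decode (to i))))

  distinct : ∀ i j → SameOrbit (representative i) (representative j) → i ≡ j
  distinct i j (S , Si≡j) = Injection.injective (↔⇒↣ count) (begin
    to i                                 ≡⟨ encode-decode (to i) ⟨
    encode (decode (to i))               ≡⟨ encode-invariant S (decode (to i)) ⟨
    encode (map (S ⊙_) (decode (to i)))  ≡⟨ cong encode (columns-act-representative S i) ⟨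
    encode (columns (act S (representative i)))  ≡⟨ cong (encode ∘ columns) Si≡j ⟩
    encode (columns (representative j))  ≡⟨ cong encode (columns-rows (decode (to j))) ⟩
    encode (decode (to j))               ≡⟨ encode-decode (to j) ⟩
    to j                                 ∎)

  exhaustive : ∀ x → ∃ λ i → SameOrbit (representative i) x
  exhaustive x with realise (columns x)
  ... | c , S , Sc≡x = from c , S , columns-injective (begin
    columns (act S (representative (from c)))  ≡⟨ columns-act-representative S (from c) ⟩
    map (S ⊙_) (decode (to (from c)))          ≡⟨ cong (map (S ⊙_) ∘ decode) (strictlyInverseˡ c) ⟩
    map (S ⊙_) (decode c)                      ≡⟨ Sc≡x ⟩
    columns x                                  ∎)

orbitCount : ∀ n → HasOrbitCount n (size₀ n)
orbitCount n = hasOrbitCount (size₀↔Canonical₀ n) decode₀ encode₀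
  (λ S → Invariance.encode₀-invariant (⊙-injective S) (⊙-𝟎 S))
  encode₀-decode₀
  (Realisation.realise₀ _⊙_ ⊙-𝟎 ⊙-injective ⊙-surjective ⊙-basis)

-- The closed formula

4^≡2^*2^ : ∀ m → 4 ^ m ≡ 2 ^ m * 2 ^ m
4^≡2^*2^ zero = refl
4^≡2^*2^ (suc m) = trans (cong (4 *_) (4^≡2^*2^ m)) (square-double (2 ^ m))
  where
  square-double : ∀ p → 4 * (p * p) ≡ 2 * p * (2 * p)
  square-double = solve-∀

size₁-closed : ∀ m → 2 * size₁ m ≡ 2 ^ m * (2 ^ m + 1)
size₁-closed zero = refl
size₁-closed (suc m) = begin
  2 * (size₁ m + (size₁ m + 4 ^ m))      ≡⟨ regroup (size₁ m) (4 ^ m) ⟩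
  2 * size₁ m + 2 * size₁ m + 2 * 4 ^ m  ≡⟨ cong₂ (λ s q → s + s + 2 * q) (size₁-closed m) (4^≡2^*2^ m) ⟩
  p * (p + 1) + p * (p + 1) + 2 * (p * p) ≡⟨ collect p ⟩
  2 * p * (2 * p + 1)                    ∎
  where
  p : ℕ
  p = 2 ^ m
  regroup : ∀ s q → 2 * (s + (s + q)) ≡ 2 * s + 2 * s + 2 * q
  regroup = solve-∀
  collect : ∀ p → p * (p + 1) + p * (p + 1) + 2 * (p * p) ≡ 2 * p * (2 * p + 1)
  collect = solve-∀

size₀-closed : ∀ m → 6 * size₀ m ≡ (2 ^ m + 1) * (2 ^ m + 2)
size₀-closed zero = refl
size₀-closed (suc m) = begin
  6 * (size₀ m + size₁ m)                   ≡⟨ regroup (size₀ m) (size₁ m) ⟩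
  6 * size₀ m + 3 * (2 * size₁ m)           ≡⟨ cong₂ (λ t s → t + 3 * s) (size₀-closed m) (size₁-closed m) ⟩
  (p + 1) * (p + 2) + 3 * (p * (p + 1))     ≡⟨ collect p ⟩
  (2 * p + 1) * (2 * p + 2)                 ∎
  where
  p : ℕ
  p = 2 ^ m
  regroup : ∀ t s → 6 * (t + s) ≡ 6 * t + 3 * (2 * s)
  regroup = solve-∀
  collect : ∀ p → (p + 1) * (p + 2) + 3 * (p * (p + 1)) ≡ (2 * p + 1) * (2 * p + 2)
  collect = solve-∀

size₀-product : ∀ m → size₀ (suc m) * 3 ≡ (2 ^ suc m + 1) * (2 ^ m + 1)
size₀-product m = *-cancelˡ-≡ _ _ 2 (begin
  2 * (size₀ (suc m) * 3)          ≡⟨ six (size₀ (suc m)) ⟩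
  6 * size₀ (suc m)                ≡⟨ size₀-closed (suc m) ⟩
  (2 * p + 1) * (2 * p + 2)        ≡⟨ halve p ⟩
  2 * ((2 * p + 1) * (p + 1))      ∎)
  where
  p : ℕ
  p = 2 ^ m
  six : ∀ s → 2 * (s * 3) ≡ 6 * s
  six = solve-∀
  halve : ∀ p → (2 * p + 1) * (2 * p + 2) ≡ 2 * ((2 * p + 1) * (p + 1))
  halve = solve-∀

numerator-product : ∀ m →
  2 ^ (2 * suc m ∸ 1) + 2 ^ (suc m + 1) ∸ 2 ^ (suc m ∸ 1) + 1 ≡ (2 ^ suc m + 1) * (2 ^ m + 1)
numerator-product m = begin
  2 ^ (2 * suc m ∸ 1) + 2 ^ (suc m + 1) ∸ p + 1
    ≡⟨ cong₂ (λ x y → x + y ∸ p + 1) 2^[2n∸1] (^-distribˡ-+-* 2 (suc m) 1) ⟩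
  p * (2 * p) + 2 * p * 2 ∸ p + 1     ≡⟨ cong (λ x → x ∸ p + 1) (regroup p) ⟩
  2 * (p * p) + 3 * p + p ∸ p + 1     ≡⟨ cong (_+ 1) (m+n∸n≡m (2 * (p * p) + 3 * p) p) ⟩
  2 * (p * p) + 3 * p + 1             ≡⟨ factor p ⟩
  (2 * p + 1) * (p + 1)               ∎
  where
  p : ℕ
  p = 2 ^ m
  2^[2n∸1] : 2 ^ (2 * suc m ∸ 1) ≡ p * (2 * p)
  2^[2n∸1] = trans (cong (λ k → 2 ^ (m + k)) (+-identityʳ (suc m))) (^-distribˡ-+-* 2 m (suc m))
  regroup : ∀ p → p * (2 * p) + 2 * p * 2 ≡ 2 * (p * p) + 3 * p + p
  regroup = solve-∀
  factor : ∀ p → 2 * (p * p) + 3 * p + 1 ≡ (2 * p + 1) * (p + 1)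
  factor = solve-∀

corollary5 : ∀ (n : ℕ) → n ≥ 1 →
    (3 ∣ (2 ^ (2 * n ∸ 1) + 2 ^ (n + 1) ∸ 2 ^ (n ∸ 1) + 1)) ×
    HasOrbitCount n ((2 ^ (2 * n ∸ 1) + 2 ^ (n + 1) ∸ 2 ^ (n ∸ 1) + 1) / 3) ×
    ((2 ^ (2 * n ∸ 1) + 2 ^ (n + 1) ∸ 2 ^ (n ∸ 1) + 1) / 3 ≡ ((2 ^ n + 1) * (2 ^ (n ∸ 1) + 1)) / 3)
corollary5 zero ()
corollary5 (suc m) _ =
  divides (size₀ (suc m)) numerator≡size*3 ,
  subst (HasOrbitCount (suc m)) (sym numerator/3≡size) (orbitCount (suc m)) ,
  trans numerator/3≡size (sym product/3≡size)
  where
  numerator : ℕ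
  numerator = 2 ^ (2 * suc m ∸ 1) + 2 ^ (suc m + 1) ∸ 2 ^ (suc m ∸ 1) + 1
  numerator≡size*3 : numerator ≡ size₀ (suc m) * 3
  numerator≡size*3 = trans (numerator-product m) (sym (size₀-product m))
  numerator/3≡size : numerator / 3 ≡ size₀ (suc m)
  numerator/3≡size = trans (cong (_/ 3) numerator≡size*3) (m*n/n≡m (size₀ (suc m)) 3)
  product/3≡size : (2 ^ suc m + 1) * (2 ^ m + 1) / 3 ≡ size₀ (suc m)
  product/3≡size = trans (cong (_/ 3) (sym (size₀-product m))) (m*n/n≡m (size₀ (suc m)) 3)
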